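{- Under the Modified CFLS coloring $\varphi$ of $K_n$ ($n=2^{m^2}$), there is no copy of $K_5$ which is a 2-2-2-2-2 coloring in which all five color classes are matchings.
   Context: Let $m$ be a positive integer and $n=2^{m^2}$. The vertices of $K_n$ are the binary strings $v\in\{0,1\}^{m^2}$, written as $v=(v^{(1)},\dots,v^{(m)})$ with each block $v^{(k)}\in\{0,1\}^m$. Vertices (and blocks) are linearly ordered as binary integers: $x<y$ iff at the first bit where they differ, $x$ has 0 and $y$ has 1. For $x<y$, let $i$ be the first index with $x^{(i)}\ne y^{(i)}$; for $k\in[m]$ let $i_k$ be the first position at which the bits of $x^{(k)}$ and $y^{(k)}$ differ ($i_k=0$ if $x^{(k)}=y^{(k)}$), and let $\delta_k=+1$ if $x^{(k)}\le y^{(k)}$ and $\delta_k=-1$ if $x^{(k)}>y^{(k)}$. The Modified CFLS coloring assigns to edge $xy$ the color $\varphi(xy)=((i,\{x^{(i)},y^{(i)}\}),i_1,\dots,i_m,\delta_1,\dots,\delta_m)$. A copy of $K_5$ is a 2-2-2-2-2 coloring if its ten edges receive exactly five colors, each on exactly two edges; a color class is a matching if its two edges are disjoint. -}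

module Defs where

open import Data.Bool using (Bool; true; false; if_then_else_; _∧_)
open import Data.Nat using (ℕ; zero; suc; _*_; _<_)
open import Data.Integer using (ℤ; +_; -_)
open import Data.Fin using (Fin; toℕ)
open import Data.Vec using (Vec; []; _∷_; concat; lookup)
open import Data.Maybe using (Maybe; just; nothing)
open import Data.Product using (_×_; _,_; Σ)
open import Data.List using (List; length; filter; map) renaming ([] to []ᴸ; _∷_ to _∷ᴸ_)
open import Data.List.Membership.Propositional using (_∈_)
open import Relation.Binary.PropositionalEquality using (_≡_; _≢_)
open import Relation.Binary.Definitions using (DecidableEquality)
open import Relation.Nullary using (¬_)
import Data.Bool.Properties as BoolP
import Data.Nat.Properties as NatP
import Data.Integer.Properties as IntP
import Data.Fin.Properties as FinP
import Data.Vec.Properties as VecP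
import Data.Product.Properties as ProdP
import Data.Maybe.Properties as MaybeP

Block : ℕ → Set
Block m = Vec Bool m

-- a vertex is a binary string of length m², written as m blocks of length m
Vertex : ℕ → Set
Vertex m = Vec (Block m) m

bits : ∀ {m} → Vertex m → Vec Bool (m * m)
bits = concat

ltBits : ∀ {k} → Vec Bool k → Vec Bool k → Bool
ltBits []          []          = false
ltBits (false ∷ a) (true  ∷ b) = true
ltBits (true  ∷ a) (false ∷ b) = false
ltBits (false ∷ a) (false ∷ b) = ltBits a b
ltBits (true  ∷ a) (true  ∷ b) = ltBits a b

ltV : ∀ {m} → Vertex m → Vertex m → Bool
ltV x y = ltBits (bits x) (bits y)

-- first (1-indexed) position where two bit strings differ; 0 if equal
firstDiffPos : ∀ {k} → Vec Bool k → Vec Bool k → ℕ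
firstDiffPos []      []      = 0
firstDiffPos (a ∷ u) (b ∷ v) with a BoolP.≟ b
... | Relation.Nullary.yes _ = firstDiffPos′ (firstDiffPos u v)
  where
    firstDiffPos′ : ℕ → ℕ
    firstDiffPos′ zero    = zero
    firstDiffPos′ (suc n) = suc (suc n)
... | Relation.Nullary.no _  = 1

firstDiffBlock : ∀ {m k} → Vec (Block m) k → Vec (Block m) k → Maybe (Fin k)
firstDiffBlock []      []      = nothing
firstDiffBlock (a ∷ u) (b ∷ v) with VecP.≡-dec BoolP._≟_ a b
... | Relation.Nullary.no _  = just Fin.zero
  where import Data.Fin as Fin
... | Relation.Nullary.yes _ with firstDiffBlock u v
...   | nothing = nothing
...   | just j  = just (Fin.suc j)
  where import Data.Fin as Fin

delta : ∀ {m} → Block m → Block m → ℤ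
delta a b = if ltBits b a then - (+ 1) else + 1

-- the unordered pair {a , b} of blocks, represented canonically as (min , max)
unorderedPair : ∀ {m} → Block m → Block m → Block m × Block m
unorderedPair a b = if ltBits b a then (b , a) else (a , b)

Colour : ℕ → Set
Colour m = Maybe (Fin m × (Block m × Block m)) × Vec ℕ m × Vec ℤ m

zipWithV : ∀ {A B C : Set} {k} → (A → B → C) → Vec A k → Vec B k → Vec C k
zipWithV f []      []      = []
zipWithV f (a ∷ u) (b ∷ v) = f a b ∷ zipWithV f u v

-- colour of the pair (x , y), to be used when x < y
colourOrd : ∀ {m} → Vertex m → Vertex m → Colour m
colourOrd {m} x y =
  ( firstPart (firstDiffBlock x y)
  , zipWithV firstDiffPos x y
  , zipWithV delta x y )
  where
    firstPart : Maybe (Fin m) → Maybe (Fin m × (Block m × Block m))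
    firstPart nothing  = nothing
    firstPart (just i) = just (i , unorderedPair (lookup x i) (lookup y i))

φ : ∀ {m} → Vertex m → Vertex m → Colour m
φ x y = if ltV x y then colourOrd x y else colourOrd y x

_≟ᶜ_ : ∀ {m} → DecidableEquality (Colour m)
_≟ᶜ_ = ProdP.≡-dec (MaybeP.≡-dec (ProdP.≡-dec FinP._≟_ (ProdP.≡-dec (VecP.≡-dec BoolP._≟_) (VecP.≡-dec BoolP._≟_))))
         (ProdP.≡-dec (VecP.≡-dec NatP._≟_) (VecP.≡-dec IntP._≟_))

Edge5 : Set
Edge5 = Fin 5 × Fin 5

edgesK5 : List Edge5
edgesK5 =
  (# 0 , # 1) ∷ᴸ (# 0 , # 2) ∷ᴸ (# 0 , # 3) ∷ᴸ (# 0 , # 4) ∷ᴸ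
  (# 1 , # 2) ∷ᴸ (# 1 , # 3) ∷ᴸ (# 1 , # 4) ∷ᴸ
  (# 2 , # 3) ∷ᴸ (# 2 , # 4) ∷ᴸ
  (# 3 , # 4) ∷ᴸ []ᴸ
  where open import Data.Fin using (#_)

edgeColour : ∀ {m} → (Fin 5 → Vertex m) → Edge5 → Colour m
edgeColour f (a , b) = φ (f a) (f b)

Disjoint : Edge5 → Edge5 → Set
Disjoint (a , b) (c , d) = a ≢ c × a ≢ d × b ≢ c × b ≢ d

-- the copy of K5 is a 2-2-2-2-2 coloring: every colour occurring on the copy
-- occurs on exactly two of its ten edges (hence exactly five colours)
Is22222 : ∀ {m} → (Fin 5 → Vertex m) → Set
Is22222 f = ∀ e → e ∈ edgesK5 →
  length (filter (λ e′ → edgeColour f e′ ≟ᶜ edgeColour f e) edgesK5) ≡ 2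

AllClassesMatchings : ∀ {m} → (Fin 5 → Vertex m) → Set
AllClassesMatchings f = ∀ e e′ → e ∈ edgesK5 → e′ ∈ edgesK5 → e ≢ e′ →
  edgeColour f e ≡ edgeColour f e′ → Disjoint e e′

-- Restrict the colouring to its first coordinate (i, {x⁽ⁱ⁾, y⁽ⁱ⁾}) and look at the first block
-- in which the five vertices do not all agree. Edges inside a class of equal blocks get a later
-- index there, edges between two classes get this block together with the two blocks they join,
-- so equally coloured edges are compatible with the partition into classes. A perfect pairing of
-- the ten edges into disjoint equally coloured pairs is then impossible: a singleton class {v}
-- leaves an edge at v with no admissible partner, and in the only other partition, 3 + 2, two
-- meeting edges of the triangle both have the edge of the pair class as their only possible
-- partner, hence share a colour. So all five vertices agree on every block, contradicting
-- injectivity.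
module Submission where

open import Defs
open import Data.Nat using (ℕ; _≤_)
open import Data.Fin using (Fin)
open import Data.Product using (_×_)
open import Relation.Nullary using (¬_)
open import Relation.Binary.PropositionalEquality using (_≡_)
open import Function.Definitions using (Injective)

open import Data.Bool using (Bool; true; false)
import Data.Bool.Properties as Bool
open import Data.Empty using (⊥-elim)
open import Data.Fin using (zero; suc; _≟_)
import Data.Fin.Properties as Fin
open import Data.List using (List; []; _∷_; filter; length)
import Data.List.Properties as List
open import Data.List.Membership.Propositional using (_∈_; find)
open import Data.List.Membership.Propositional.Properties using (∈-filter⁺; ∈-filter⁻)
open import Data.List.Relation.Unary.All using (All)
import Data.List.Relation.Unary.All as All
open import Data.List.Relation.Unary.AllPairs using (_∷_)
open import Data.List.Relation.Unary.Any using (Any; here; there)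
import Data.List.Relation.Unary.Any as Any
open import Data.List.Relation.Unary.Any.Properties using (¬Any[])
open import Data.List.Relation.Unary.Unique.Propositional using (Unique)
open import Data.List.Relation.Unary.Unique.Propositional.Properties using (filter⁺)
open import Data.List.Relation.Unary.Unique.DecPropositional using (unique?)
open import Data.Maybe using (Maybe; just; nothing)
import Data.Maybe as Maybe
open import Data.Product using (_,_; proj₁; ∃-syntax)
open import Data.Product.Properties using (≡-dec)
open import Data.Sum using (_⊎_; inj₁; inj₂; [_,_]′)
open import Data.Vec using (Vec; []; _∷_; head; tail; lookup; tabulate)
import Data.Vec.Properties as Vec
open import Function using (_∘_; id; _on_)
open import Relation.Binary.Core using (_⇒_)
open import Relation.Binary.Definitions using (DecidableEquality)
open import Relation.Binary.PropositionalEquality using (refl; sym; trans; cong; subst; _≢_; module ≡-Reasoning)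
open import Relation.Nullary using (Dec; yes; no; ¬?; _×-dec_; _⊎-dec_)
open import Relation.Nullary.Decidable using (map′; toWitness)

_≟ₑ_ : DecidableEquality Edge5
_≟ₑ_ = ≡-dec _≟_ _≟_

disjoint? : ∀ e e′ → Dec (Disjoint e e′)
disjoint? (a , b) (c , d) = ¬? (a ≟ c) ×-dec ¬? (a ≟ d) ×-dec ¬? (b ≟ c) ×-dec ¬? (b ≟ d)

edgesK5-unique : Unique edgesK5
edgesK5-unique = toWitness {a? = unique? _≟ₑ_ edgesK5} _

module _ {C : Set} (c : Edge5 → C) where

  EveryColourRepeats : Set
  EveryColourRepeats = ∀ e → e ∈ edgesK5 → ∃[ e′ ] e′ ∈ edgesK5 × e′ ≢ e × c e ≡ c e′

  ColourClassesMatchings : Set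
  ColourClassesMatchings = ∀ e e′ → e ∈ edgesK5 → e′ ∈ edgesK5 → e ≢ e′ → c e ≡ c e′ → Disjoint e e′

length-filter≡2⇒other : ∀ {A : Set} → DecidableEquality A → {P : A → Set} (P? : ∀ x → Dec (P x))
  {xs : List A} → Unique xs → length (filter P? xs) ≡ 2 → ∀ y → ∃[ x ] x ∈ xs × x ≢ y × P x
-- length≡2 is abstracted by the with, which rules out every other shape of the filtered list.
length-filter≡2⇒other _≟ᴬ_ P? {xs} unique length≡2 y
  with filter P? xs | filter⁺ P? unique | (λ {x} → ∈-filter⁻ P? {x} {xs})
... | p ∷ q ∷ [] | (p≢q All.∷ All.[]) ∷ _ | kept with p ≟ᴬ y
...   | yes refl = let q∈ , Pq = kept (there (here refl)) in q , q∈ , (λ q≡p → p≢q (sym q≡p)) , Pq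
...   | no p≢y   = let p∈ , Pp = kept (here refl) in p , p∈ , p≢y , Pp

Is22222⇒EveryColourRepeats : ∀ {m} (f : Fin 5 → Vertex m) → Is22222 f → EveryColourRepeats (edgeColour f)
Is22222⇒EveryColourRepeats f twice e e∈
  with length-filter≡2⇒other _≟ₑ_ (λ e′ → edgeColour f e′ ≟ᶜ edgeColour f e) edgesK5-unique (twice e e∈) e
... | e′ , e′∈ , e′≢e , same = e′ , e′∈ , e′≢e , sym same

module _ {A : Set} (h : Fin 5 → A) where

  Monochromatic : Edge5 → Set
  Monochromatic (a , b) = h a ≡ h b

  SameEnds : Edge5 → Edge5 → Set
  SameEnds (a , b) (c , d) = (h a ≡ h c × h b ≡ h d) ⊎ (h a ≡ h d × h b ≡ h c)

  Compatible : Edge5 → Edge5 → Set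
  Compatible e e′ = (Monochromatic e × Monochromatic e′) ⊎ SameEnds e e′

Compatible-map : ∀ {A B : Set} {h : Fin 5 → A} {h′ : Fin 5 → B} →
  (∀ {a b} → h a ≡ h b → h′ a ≡ h′ b) → ∀ {e e′} → Compatible h e e′ → Compatible h′ e e′
Compatible-map f (inj₁ (p , q))        = inj₁ (f p , f q)
Compatible-map f (inj₂ (inj₁ (p , q))) = inj₂ (inj₁ (f p , f q))
Compatible-map f (inj₂ (inj₂ (p , q))) = inj₂ (inj₂ (f p , f q))

Labelling : Set
Labelling = Vec (Fin 5) 5

module _ (ℓ : Labelling) where

  compatible? : ∀ e e′ → Dec (Compatible (lookup ℓ) e e′)
  compatible? (a , b) (c , d) =
    (lookup ℓ a ≟ lookup ℓ b ×-dec lookup ℓ c ≟ lookup ℓ d) ⊎-dec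
    (lookup ℓ a ≟ lookup ℓ c ×-dec lookup ℓ b ≟ lookup ℓ d) ⊎-dec
    (lookup ℓ a ≟ lookup ℓ d ×-dec lookup ℓ b ≟ lookup ℓ c)

  candidate? : ∀ e e′ → Dec (e′ ≢ e × Disjoint e e′ × Compatible (lookup ℓ) e e′)
  candidate? e e′ = ¬? (e′ ≟ₑ e) ×-dec disjoint? e e′ ×-dec compatible? e e′

  candidates : Edge5 → List Edge5
  candidates e = filter (candidate? e) edgesK5

  Constant : Set
  Constant = ∀ a → lookup ℓ a ≡ lookup ℓ zero

  PartnerlessEdge : Set
  PartnerlessEdge = Any (λ e → candidates e ≡ []) edgesK5

  ForcedCommonPartner : Set
  ForcedCommonPartner = Any (λ e₁ → Any (λ e₂ → e₁ ≢ e₂ × ¬ Disjoint e₁ e₂ ×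
    All (λ p₁ → All (p₁ ≡_) (candidates e₂)) (candidates e₁)) edgesK5) edgesK5

  constant-or-refutable? : Dec (Constant ⊎ PartnerlessEdge ⊎ ForcedCommonPartner)
  constant-or-refutable? =
    Fin.all? (λ a → lookup ℓ a ≟ lookup ℓ zero) ⊎-dec
    Any.any? (λ e → List.≡-dec _≟ₑ_ (candidates e) []) edgesK5 ⊎-dec
    Any.any? (λ e₁ → Any.any? (λ e₂ → ¬? (e₁ ≟ₑ e₂) ×-dec ¬? (disjoint? e₁ e₂) ×-dec
      All.all? (λ p₁ → All.all? (p₁ ≟ₑ_) (candidates e₂)) (candidates e₁)) edgesK5) edgesK5

∀-vec? : ∀ {n k} {P : Vec (Fin k) n → Set} → (∀ v → Dec (P v)) → Dec (∀ v → P v)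
∀-vec? {ℕ.zero}  P? = map′ (λ p → λ { [] → p }) (λ p → p []) (P? [])
∀-vec? {ℕ.suc n} P? = map′ (λ p → λ { (a ∷ v) → p a v }) (λ p a v → p (a ∷ v))
  (Fin.all? (λ a → ∀-vec? (λ v → P? (a ∷ v))))

-- Decided by exhaustive search over all 5⁵ labellings.
constant-or-refutable : ∀ ℓ → Constant ℓ ⊎ PartnerlessEdge ℓ ⊎ ForcedCommonPartner ℓ
constant-or-refutable = toWitness {a? = ∀-vec? constant-or-refutable?} _

module _ {C : Set} {c : Edge5 → C} (repeats : EveryColourRepeats c) (matching : ColourClassesMatchings c)
  (ℓ : Labelling) (compatible : (_≡_ on c) ⇒ Compatible (lookup ℓ)) where

  partner∈candidates : ∀ {e} → e ∈ edgesK5 → ∃[ p ] p ∈ candidates ℓ e × c e ≡ c p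
  partner∈candidates {e} e∈ with repeats e e∈
  ... | p , p∈ , p≢e , same =
    p , ∈-filter⁺ (candidate? ℓ e) p∈ (p≢e , matching e p e∈ p∈ (p≢e ∘ sym) same , compatible same) , same

  ¬PartnerlessEdge : ¬ PartnerlessEdge ℓ
  ¬PartnerlessEdge partnerless with find partnerless
  ... | e , e∈ , none with partner∈candidates e∈
  ... | p , p∈ , _ = ¬Any[] (subst (p ∈_) none p∈)

  ¬ForcedCommonPartner : ¬ ForcedCommonPartner ℓ
  ¬ForcedCommonPartner forced with find forced
  ... | e₁ , e₁∈ , forced₁ with find forced₁
  ... | e₂ , e₂∈ , e₁≢e₂ , meet , common
    with partner∈candidates e₁∈ | partner∈candidates e₂∈
  ... | p₁ , p₁∈ , same₁ | p₂ , p₂∈ , same₂ =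
    meet (matching e₁ e₂ e₁∈ e₂∈ e₁≢e₂ (trans same₁ (trans (cong c p₁≡p₂) (sym same₂))))
    where
    p₁≡p₂ : p₁ ≡ p₂
    p₁≡p₂ = All.lookup (All.lookup common p₁∈) p₂∈

  compatible-finite-labelling-constant : Constant ℓ
  compatible-finite-labelling-constant =
    [ id , [ ⊥-elim ∘ ¬PartnerlessEdge , ⊥-elim ∘ ¬ForcedCommonPartner ]′ ]′ (constant-or-refutable ℓ)

module _ {A : Set} (_≟ᴬ_ : DecidableEquality A) (h : Fin 5 → A) where

  open ≡-Reasoning

  representative : A → Fin 5
  representative x with Fin.any? (λ i → h i ≟ᴬ x)
  ... | yes (i , _) = i
  ... | no _        = zero

  representative-sound : ∀ a → h (representative (h a)) ≡ h a
  representative-sound a with Fin.any? (λ i → h i ≟ᴬ h a)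
  ... | yes (_ , hi≡ha) = hi≡ha
  ... | no none         = ⊥-elim (none (a , refl))

  canonicalLabelling : Labelling
  canonicalLabelling = tabulate (representative ∘ h)

  canonicalLabelling-≡⁺ : ∀ {a b} → h a ≡ h b → lookup canonicalLabelling a ≡ lookup canonicalLabelling b
  canonicalLabelling-≡⁺ {a} {b} ha≡hb = begin
    lookup canonicalLabelling a ≡⟨ Vec.lookup∘tabulate (representative ∘ h) a ⟩
    representative (h a)        ≡⟨ cong representative ha≡hb ⟩
    representative (h b)        ≡⟨ Vec.lookup∘tabulate (representative ∘ h) b ⟨
    lookup canonicalLabelling b ∎

  canonicalLabelling-≡⁻ : ∀ {a b} → lookup canonicalLabelling a ≡ lookup canonicalLabelling b → h a ≡ h b
  canonicalLabelling-≡⁻ {a} {b} eq = begin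
    h a                             ≡⟨ representative-sound a ⟨
    h (representative (h a))        ≡⟨ cong h (Vec.lookup∘tabulate (representative ∘ h) a) ⟨
    h (lookup canonicalLabelling a) ≡⟨ cong h eq ⟩
    h (lookup canonicalLabelling b) ≡⟨ cong h (Vec.lookup∘tabulate (representative ∘ h) b) ⟩
    h (representative (h b))        ≡⟨ representative-sound b ⟩
    h b                             ∎

compatible-labelling-constant : ∀ {C : Set} {c : Edge5 → C} → EveryColourRepeats c → ColourClassesMatchings c →
  ∀ {A : Set} → DecidableEquality A → (h : Fin 5 → A) → (_≡_ on c) ⇒ Compatible h → ∀ a → h a ≡ h zero
compatible-labelling-constant repeats matching _≟ᴬ_ h compatible a =
  canonicalLabelling-≡⁻ _≟ᴬ_ h
    (compatible-finite-labelling-constant repeats matching (canonicalLabelling _≟ᴬ_ h)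
      (λ {e} {e′} same → Compatible-map (canonicalLabelling-≡⁺ _≟ᴬ_ h) {e} {e′} (compatible same)) a)

ltBits-asym : ∀ {k} (u v : Vec Bool k) → ltBits u v ≡ true → ltBits v u ≡ false
ltBits-asym []          []          ()
ltBits-asym (false ∷ _) (true  ∷ _) _  = refl
ltBits-asym (false ∷ u) (false ∷ v) lt = ltBits-asym u v lt
ltBits-asym (true  ∷ u) (true  ∷ v) lt = ltBits-asym u v lt

ltBits-connex : ∀ {k} (u v : Vec Bool k) → ltBits u v ≡ false → ltBits v u ≡ false → u ≡ v
ltBits-connex []          []          _  _  = refl
ltBits-connex (false ∷ u) (false ∷ v) uv vu = cong (false ∷_) (ltBits-connex u v uv vu)
ltBits-connex (true  ∷ u) (true  ∷ v) uv vu = cong (true ∷_) (ltBits-connex u v uv vu)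

module _ {m : ℕ} where

  _≟ᵇ_ : DecidableEquality (Block m)
  _≟ᵇ_ = Vec.≡-dec Bool._≟_

  unorderedPair-comm : ∀ {a b : Block m} → a ≢ b → unorderedPair a b ≡ unorderedPair b a
  unorderedPair-comm {a} {b} a≢b with ltBits b a in ba | ltBits a b in ab
  ... | true  | true  with () ← trans (sym ab) (ltBits-asym b a ba)
  ... | true  | false = refl
  ... | false | true  = refl
  ... | false | false = ⊥-elim (a≢b (ltBits-connex a b ab ba))

  unorderedPair-injective : ∀ {a b c d : Block m} → unorderedPair a b ≡ unorderedPair c d →
    (a ≡ c × b ≡ d) ⊎ (a ≡ d × b ≡ c)
  unorderedPair-injective {a} {b} {c} {d} eq with ltBits b a | ltBits d c | eq
  ... | true  | true  | refl = inj₁ (refl , refl)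
  ... | true  | false | refl = inj₂ (refl , refl)
  ... | false | true  | refl = inj₂ (refl , refl)
  ... | false | false | refl = inj₁ (refl , refl)

  FirstDifference : ℕ → Set
  FirstDifference k = Maybe (Fin k × (Block m × Block m))

  firstDifference : ∀ {k} → Vec (Block m) k → Vec (Block m) k → FirstDifference k
  firstDifference x y = Maybe.map (λ i → i , unorderedPair (lookup x i) (lookup y i)) (firstDiffBlock x y)

  shift : ∀ {k} → FirstDifference k → FirstDifference (ℕ.suc k)
  shift nothing        = nothing
  shift (just (i , P)) = just (suc i , P)

  shift-injective : ∀ {k} {u v : FirstDifference k} → shift u ≡ shift v → u ≡ v
  shift-injective {u = nothing}      {nothing}      refl = refl
  shift-injective {u = just (_ , _)} {just (_ , _)} refl = refl

  shift≢zero : ∀ {k} (u : FirstDifference k) P → shift u ≢ just (zero , P)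
  shift≢zero nothing  _ ()
  shift≢zero (just _) _ ()

  firstDifference-head-≢ : ∀ {k} (x y : Vec (Block m) (ℕ.suc k)) → head x ≢ head y →
    firstDifference x y ≡ just (zero , unorderedPair (head x) (head y))
  firstDifference-head-≢ (a ∷ _) (b ∷ _) a≢b with a ≟ᵇ b
  ... | yes a≡b = ⊥-elim (a≢b a≡b)
  ... | no _    = refl

  firstDifference-head-≡ : ∀ {k} (x y : Vec (Block m) (ℕ.suc k)) → head x ≡ head y →
    firstDifference x y ≡ shift (firstDifference (tail x) (tail y))
  firstDifference-head-≡ (a ∷ x) (b ∷ y) a≡b with a ≟ᵇ b
  ... | no a≢b = ⊥-elim (a≢b a≡b)
  ... | yes _ with firstDiffBlock x y
  ...   | nothing = refl
  ...   | just _  = refl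

  firstDifference-comm : ∀ {k} (x y : Vec (Block m) k) → firstDifference x y ≡ firstDifference y x
  firstDifference-comm []          []          = refl
  firstDifference-comm x@(a ∷ _) y@(b ∷ _) = byHeads (a ≟ᵇ b)
    where
    open ≡-Reasoning
    byHeads : Dec (a ≡ b) → firstDifference x y ≡ firstDifference y x
    byHeads (yes a≡b) = begin
      firstDifference x y                       ≡⟨ firstDifference-head-≡ x y a≡b ⟩
      shift (firstDifference (tail x) (tail y)) ≡⟨ cong shift (firstDifference-comm (tail x) (tail y)) ⟩
      shift (firstDifference (tail y) (tail x)) ≡⟨ firstDifference-head-≡ y x (sym a≡b) ⟨
      firstDifference y x                       ∎
    byHeads (no a≢b) = begin
      firstDifference x y             ≡⟨ firstDifference-head-≢ x y a≢b ⟩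
      just (zero , unorderedPair a b) ≡⟨ cong (just ∘ (zero ,_)) (unorderedPair-comm a≢b) ⟩
      just (zero , unorderedPair b a) ≡⟨ firstDifference-head-≢ y x (a≢b ∘ sym) ⟨
      firstDifference y x             ∎

  colourOrd-firstDifference : (x y : Vertex m) → proj₁ (colourOrd x y) ≡ firstDifference x y
  colourOrd-firstDifference x y with firstDiffBlock x y
  ... | nothing = refl
  ... | just _  = refl

  φ-firstDifference : (x y : Vertex m) → proj₁ (φ x y) ≡ firstDifference x y
  φ-firstDifference x y with ltV x y
  ... | true  = colourOrd-firstDifference x y
  ... | false = trans (colourOrd-firstDifference y x) (firstDifference-comm y x)

  edgeDifference : ∀ {k} → (Fin 5 → Vec (Block m) k) → Edge5 → FirstDifference k
  edgeDifference g (a , b) = firstDifference (g a) (g b)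

  edgeColour-edgeDifference : (f : Fin 5 → Vertex m) → ∀ e → proj₁ (edgeColour f e) ≡ edgeDifference f e
  edgeColour-edgeDifference f (a , b) = φ-firstDifference (f a) (f b)

  edgeDifference-compatible : ∀ {k} (g : Fin 5 → Vec (Block m) (ℕ.suc k)) →
    (_≡_ on edgeDifference g) ⇒ Compatible (head ∘ g)
  edgeDifference-compatible g {a , b} {c , d} eq
    with head (g a) ≟ᵇ head (g b) | head (g c) ≟ᵇ head (g d)
  ... | yes p | yes q = inj₁ (p , q)
  ... | yes p | no q  = ⊥-elim (shift≢zero _ _
        (trans (sym (firstDifference-head-≡ (g a) (g b) p)) (trans eq (firstDifference-head-≢ (g c) (g d) q))))
  ... | no p  | yes q = ⊥-elim (shift≢zero _ _
        (trans (sym (firstDifference-head-≡ (g c) (g d) q)) (trans (sym eq) (firstDifference-head-≢ (g a) (g b) p))))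
  ... | no p  | no q  = inj₂ (unorderedPair-injective (zero-pair-injective
        (trans (sym (firstDifference-head-≢ (g a) (g b) p)) (trans eq (firstDifference-head-≢ (g c) (g d) q)))))
    where
    zero-pair-injective : ∀ {P Q} → just (zero , P) ≡ just (zero , Q) → P ≡ Q
    zero-pair-injective refl = refl

  edgeDifference-tail : ∀ {k} (g : Fin 5 → Vec (Block m) (ℕ.suc k)) → (∀ a → head (g a) ≡ head (g zero)) →
    ∀ e → edgeDifference g e ≡ shift (edgeDifference (tail ∘ g) e)
  edgeDifference-tail g same-head (a , b) =
    firstDifference-head-≡ (g a) (g b) (trans (same-head a) (sym (same-head b)))

  module _ {C : Set} {c : Edge5 → C} (repeats : EveryColourRepeats c) (matching : ColourClassesMatchings c) where

    colour-determines-difference⇒¬injective : ∀ {k} (g : Fin 5 → Vec (Block m) k) →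
      (_≡_ on c) ⇒ (_≡_ on edgeDifference g) → ¬ Injective _≡_ _≡_ g
    colour-determines-difference⇒¬injective {ℕ.zero} g _ injective =
      Fin.0≢1+n (injective (empty-unique (g zero) (g (suc zero))))
      where
      empty-unique : (x y : Vec (Block m) 0) → x ≡ y
      empty-unique [] [] = refl
    colour-determines-difference⇒¬injective {ℕ.suc k} g determines injective =
      colour-determines-difference⇒¬injective (tail ∘ g) tails-determined tails-injective
      where
      same-head : ∀ a → head (g a) ≡ head (g zero)
      same-head = compatible-labelling-constant repeats matching _≟ᵇ_ (head ∘ g)
        (edgeDifference-compatible g ∘ determines)

      tails-determined : (_≡_ on c) ⇒ (_≡_ on edgeDifference (tail ∘ g))
      tails-determined {e} {e′} same = shift-injective (begin
        shift (edgeDifference (tail ∘ g) e)  ≡⟨ edgeDifference-tail g same-head e ⟨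
        edgeDifference g e                   ≡⟨ determines same ⟩
        edgeDifference g e′                  ≡⟨ edgeDifference-tail g same-head e′ ⟩
        shift (edgeDifference (tail ∘ g) e′) ∎)
        where open ≡-Reasoning

      tails-injective : Injective _≡_ _≡_ (tail ∘ g)
      tails-injective {a} {b} eq =
        injective (head-tail-≡ (g a) (g b) (trans (same-head a) (sym (same-head b))) eq)
        where
        head-tail-≡ : (x y : Vec (Block m) (ℕ.suc k)) → head x ≡ head y → tail x ≡ tail y → x ≡ y
        head-tail-≡ (_ ∷ _) (_ ∷ _) refl refl = refl

lemma18 : (m : ℕ) → 1 ≤ m → (f : Fin 5 → Vertex m) → Injective _≡_ _≡_ f →
    ¬ (Is22222 f × AllClassesMatchings f)
lemma18 m _ f injective (twice , matching) =
  colour-determines-difference⇒¬injective (Is22222⇒EveryColourRepeats f twice) matching f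
    determines injective
  where
  determines : (_≡_ on edgeColour f) ⇒ (_≡_ on edgeDifference f)
  determines {e} {e′} same =
    trans (sym (edgeColour-edgeDifference f e)) (trans (cong proj₁ same) (edgeColour-edgeDifference f e′))
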